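{- Let $V$ be a finite set and $\mathcal{P}$, $\mathcal{P}'$ partitions of $V$, each with at least two parts. Let $(\mathcal{S}, \mathcal{S}')$ be an optimal $C_{\wedge}$-correspondence. If $(\mathcal{S}, \mathcal{S}')$ is not mutual, then $\vert \mathcal{S} \vert \in \{1, \vert \mathcal{P} \vert - 1\}$ or $\vert \mathcal{S}' \vert \in \{1, \vert \mathcal{P}' \vert - 1\}$.
   Context: $U_{\mathcal{S}}$ denotes the union of the members of $\mathcal{S}$; $\triangle$ is symmetric difference; $\vert\cdot\vert$ applied to subsets of $V$ is cardinality (or total weight, if elements carry positive weights), and applied to $\mathcal{S}$, $\mathcal{S}'$ is the number of parts. A $C_{\wedge}$-correspondence is a pair $(\mathcal{S},\mathcal{S}')$ with $\mathcal{S}\subseteq\mathcal{P}$, $\mathcal{S}'\subseteq\mathcal{P}'$, $\mathcal{S}\notin\{\emptyset,\mathcal{P}\}$ and $\mathcal{S}'\notin\{\emptyset,\mathcal{P}'\}$; it is optimal if it minimizes $\vert U_{\mathcal{S}} \triangle U_{\mathcal{S}'}\vert$ among all $C_{\wedge}$-correspondences. A correspondence $(\mathcal{S},\mathcal{S}')$ is mutual if (1) $\vert P \cap U_{\mathcal{S}'}\vert \ge \vert P\vert/2$ for all $P\in\mathcal{S}$; (2) $\vert P \cap U_{\mathcal{S}'}\vert \le \vert P\vert/2$ for all $P\in\mathcal{P}\setminus\mathcal{S}$; (3) $\vert P' \cap U_{\mathcal{S}}\vert \ge \vert P'\vert/2$ for all $P'\in\mathcal{S}'$; (4) $\vert P'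 \cap U_{\mathcal{S}}\vert \le \vert P'\vert/2$ for all $P'\in\mathcal{P}'\setminus\mathcal{S}'$. -}

module Defs where

open import Data.Nat using (ℕ; _*_; _≤_; _≥_)
open import Data.Fin using (Fin; _≟_)
open import Data.Fin.Subset using (Subset; ∣_∣; ⊥; ⊤; _∩_; _∪_; _─_)
open import Data.Vec using (tabulate; lookup)
open import Data.Product using (_×_; ∃)
open import Relation.Nullary.Decidable using (⌊_⌋)
open import Relation.Binary.PropositionalEquality using (_≡_; _≢_)

-- The ground set V is Fin n.  A partition of V into k parts is encoded by a
-- labelling  p : Fin n → Fin k  whose every label is used; part i is the
-- preimage p⁻¹(i) (so every part is nonempty, parts are disjoint and cover V).
IsPartition : ∀ {n k} → (Fin n → Fin k) → Set
IsPartition {n} {k} p = ∀ (i : Fin k) → ∃ λ (v : Fin n) → p v ≡ i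

part : ∀ {n k} → (Fin n → Fin k) → Fin k → Subset n
part p i = tabulate λ v → ⌊ p v ≟ i ⌋

U : ∀ {n k} → (Fin n → Fin k) → Subset k → Subset n
U p S = tabulate λ v → lookup S (p v)

_△_ : ∀ {n} → Subset n → Subset n → Subset n
A △ B = (A ─ B) ∪ (B ─ A)

IsCorrespondence : ∀ {k k'} → Subset k → Subset k' → Set
IsCorrespondence S S' = (S ≢ ⊥) × (S ≢ ⊤) × (S' ≢ ⊥) × (S' ≢ ⊤)

cost : ∀ {n k k'} → (Fin n → Fin k) → (Fin n → Fin k') →
       Subset k → Subset k' → ℕ
cost p p' S S' = ∣ U p S △ U p' S' ∣

IsOptimal : ∀ {n k k'} → (Fin n → Fin k) → (Fin n → Fin k') →
            Subset k → Subset k' → Set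
IsOptimal {n} {k} {k'} p p' S S' =
  IsCorrespondence S S' ×
  (∀ (T : Subset k) (T' : Subset k') → IsCorrespondence T T' →
     cost p p' S S' ≤ cost p p' T T')

-- Mutual correspondence; "|X| ≥ |P|/2" is written  2 * |X| ≥ |P|.
IsMutual : ∀ {n k k'} → (Fin n → Fin k) → (Fin n → Fin k') →
           Subset k → Subset k' → Set
IsMutual {n} {k} {k'} p p' S S' =
  (∀ (i : Fin k) → lookup S i ≡ true →
     2 * ∣ part p i ∩ U p' S' ∣ ≥ ∣ part p i ∣) ×
  (∀ (i : Fin k) → lookup S i ≡ false →
     2 * ∣ part p i ∩ U p' S' ∣ ≤ ∣ part p i ∣) ×
  (∀ (j : Fin k') → lookup S' j ≡ true →
     2 * ∣ part p' j ∩ U p S ∣ ≥ ∣ part p' j ∣) ×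
  (∀ (j : Fin k') → lookup S' j ≡ false →
     2 * ∣ part p' j ∩ U p S ∣ ≤ ∣ part p' j ∣)
  where open import Data.Bool using (true; false)

module Submission where

-- If |S| ∉ {1, |𝒫| - 1}, moving a single part P of 𝒫 into or out of S still
-- leaves a C∧-correspondence.  Moving P out of S changes the cost
-- |U_S △ U_S'| by |P ∖ U_S'| - |P ∩ U_S'|, and moving it in by the opposite
-- amount, so optimality forces |P ∩ U_S'| ≥ |P|/2 for P ∈ S and ≤ |P|/2 for
-- P ∉ S.  As △ is symmetric the same holds for S', and (S, S') is mutual.

open import Defs
open import Data.Bool using (Bool; true; false; _∧_; not; _xor_)
open import Data.Bool.Properties using (∧-zeroʳ; ∧-identityʳ)
open import Data.Empty using (⊥-elim)
open import Data.Fin using (Fin; zero; suc) renaming (_≟_ to _≟ᶠ_)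
open import Data.Fin.Subset using (Subset; ∣_∣; ⊥; ⊤; _∩_; _─_; _∈_; inside; outside)
open import Data.Fin.Subset.Properties using (∣⊥∣≡0; ∣⊤∣≡n; ∪-comm; ∈⊤; ∉⊥)
open import Data.Nat using (ℕ; suc; _+_; _*_; _≤_; _∸_; _≟_)
open import Data.Nat.Properties
open import Algebra.Properties.CommutativeSemigroup +-commutativeSemigroup using (interchange)
open import Data.Product using (_×_; _,_)
open import Data.Sum using (_⊎_; inj₁; inj₂)
open import Data.Vec using (_∷_; []; lookup; _[_]≔_)
open import Data.Vec.Properties
  using ([]=⇒lookup; lookup⇒[]=; lookup∘tabulate; lookup-zipWith; lookup∘update; lookup∘update′)
open import Relation.Nullary using (¬_; yes; no; contradiction)
open import Relation.Nullary.Decidable using (⌊_⌋)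
open import Relation.Binary.PropositionalEquality
  using (_≡_; _≢_; refl; sym; trans; cong; cong₂; subst; subst₂; module ≡-Reasoning)

bit : Bool → ℕ
bit true  = 1
bit false = 0

∣x∷p∣ : ∀ {n} x (p : Subset n) → ∣ x ∷ p ∣ ≡ bit x + ∣ p ∣
∣x∷p∣ true  p = refl
∣x∷p∣ false p = refl

∣p∣+∣q∣≡∣r∣+∣s∣ : ∀ {n} (p q r s : Subset n) →
  (∀ v → bit (lookup p v) + bit (lookup q v) ≡ bit (lookup r v) + bit (lookup s v)) →
  ∣ p ∣ + ∣ q ∣ ≡ ∣ r ∣ + ∣ s ∣
∣p∣+∣q∣≡∣r∣+∣s∣ [] [] [] [] _ = refl
∣p∣+∣q∣≡∣r∣+∣s∣ (a ∷ p) (b ∷ q) (c ∷ r) (d ∷ s) eq = begin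
  ∣ a ∷ p ∣ + ∣ b ∷ q ∣             ≡⟨ cong₂ _+_ (∣x∷p∣ a p) (∣x∷p∣ b q) ⟩
  (bit a + ∣ p ∣) + (bit b + ∣ q ∣) ≡⟨ interchange (bit a) (∣ p ∣) (bit b) (∣ q ∣) ⟩
  (bit a + bit b) + (∣ p ∣ + ∣ q ∣) ≡⟨ cong₂ _+_ (eq zero) rest ⟩
  (bit c + bit d) + (∣ r ∣ + ∣ s ∣) ≡⟨ interchange (bit c) (bit d) (∣ r ∣) (∣ s ∣) ⟩
  (bit c + ∣ r ∣) + (bit d + ∣ s ∣) ≡⟨ cong₂ _+_ (∣x∷p∣ c r) (∣x∷p∣ d s) ⟨
  ∣ c ∷ r ∣ + ∣ d ∷ s ∣             ∎
  where
  open ≡-Reasoning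
  rest : ∣ p ∣ + ∣ q ∣ ≡ ∣ r ∣ + ∣ s ∣
  rest = ∣p∣+∣q∣≡∣r∣+∣s∣ p q r s (λ v → eq (suc v))

∣p∣≡∣p∩q∣+∣p─q∣ : ∀ {n} (p q : Subset n) → ∣ p ∣ ≡ ∣ p ∩ q ∣ + ∣ p ─ q ∣
∣p∣≡∣p∩q∣+∣p─q∣ [] [] = refl
∣p∣≡∣p∩q∣+∣p─q∣ (outside ∷ p) (inside ∷ q)  = ∣p∣≡∣p∩q∣+∣p─q∣ p q
∣p∣≡∣p∩q∣+∣p─q∣ (outside ∷ p) (outside ∷ q) = ∣p∣≡∣p∩q∣+∣p─q∣ p q
∣p∣≡∣p∩q∣+∣p─q∣ (inside ∷ p)  (inside ∷ q)  = cong suc (∣p∣≡∣p∩q∣+∣p─q∣ p q)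
∣p∣≡∣p∩q∣+∣p─q∣ (inside ∷ p)  (outside ∷ q) =
  trans (cong suc (∣p∣≡∣p∩q∣+∣p─q∣ p q)) (sym (+-suc ∣ p ∩ q ∣ ∣ p ─ q ∣))

lookup-∩ : ∀ {n} (p q : Subset n) i → lookup (p ∩ q) i ≡ lookup p i ∧ lookup q i
lookup-∩ p q i = lookup-zipWith _∧_ i p q

lookup-─ : ∀ {n} (p q : Subset n) i → lookup (p ─ q) i ≡ lookup p i ∧ not (lookup q i)
lookup-─ (x ∷ p) (inside ∷ q)  zero    = sym (∧-zeroʳ x)
lookup-─ (x ∷ p) (outside ∷ q) zero    = sym (∧-identityʳ x)
lookup-─ (_ ∷ p) (_ ∷ q)       (suc i) = lookup-─ p q i

lookup-△ : ∀ {n} (p q : Subset n) i → lookup (p △ q) i ≡ lookup p i xor lookup q i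
lookup-△ (x ∷ p) (y ∷ q) zero with x | y
... | true  | true  = refl
... | true  | false = refl
... | false | true  = refl
... | false | false = refl
lookup-△ (_ ∷ p) (_ ∷ q) (suc i) = lookup-△ p q i

△-comm : ∀ {n} (p q : Subset n) → p △ q ≡ q △ p
△-comm p q = ∪-comm (p ─ q) (q ─ p)

∣p△r∣+∣q∩r∣≡∣p′△r∣+∣q─r∣ : ∀ {n} (p p′ q r : Subset n) →
  (∀ v → lookup q v ≡ true → lookup p v ≡ true × lookup p′ v ≡ false) →
  (∀ v → lookup q v ≡ false → lookup p′ v ≡ lookup p v) →
  ∣ p △ r ∣ + ∣ q ∩ r ∣ ≡ ∣ p′ △ r ∣ + ∣ q ─ r ∣
∣p△r∣+∣q∩r∣≡∣p′△r∣+∣q─r∣ p p′ q r on-q off-q =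
  ∣p∣+∣q∣≡∣r∣+∣s∣ (p △ r) (q ∩ r) (p′ △ r) (q ─ r) λ v → begin
  bit (lookup (p △ r) v) + bit (lookup (q ∩ r) v)
    ≡⟨ cong₂ (λ a b → bit a + bit b) (lookup-△ p r v) (lookup-∩ q r v) ⟩
  bit (lookup p v xor lookup r v) + bit (lookup q v ∧ lookup r v)
    ≡⟨ toggle (lookup q v) (lookup p v) (lookup p′ v) (lookup r v) (on-q v) (off-q v) ⟩
  bit (lookup p′ v xor lookup r v) + bit (lookup q v ∧ not (lookup r v))
    ≡⟨ cong₂ (λ a b → bit a + bit b) (lookup-△ p′ r v) (lookup-─ q r v) ⟨
  bit (lookup (p′ △ r) v) + bit (lookup (q ─ r) v) ∎
  where
  open ≡-Reasoning
  toggle : ∀ x a a′ b → (x ≡ true → a ≡ true × a′ ≡ false) → (x ≡ false → a′ ≡ a) →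
           bit (a xor b) + bit (x ∧ b) ≡ bit (a′ xor b) + bit (x ∧ not b)
  toggle true  a a′ b on _ with on refl
  toggle true  _ _ true  _ _ | refl , refl = refl
  toggle true  _ _ false _ _ | refl , refl = refl
  toggle false a a′ b _ off rewrite off refl = refl

lookup-U : ∀ {n k} (p : Fin n → Fin k) (S : Subset k) v → lookup (U p S) v ≡ lookup S (p v)
lookup-U p S = lookup∘tabulate (λ w → lookup S (p w))

lookup-part : ∀ {n k} (p : Fin n → Fin k) i v → lookup (part p i) v ≡ ⌊ p v ≟ᶠ i ⌋
lookup-part p i = lookup∘tabulate (λ w → ⌊ p w ≟ᶠ i ⌋)

∈part⇒≡ : ∀ {n k} (p : Fin n → Fin k) {i v} → lookup (part p i) v ≡ true → p v ≡ i
∈part⇒≡ p {i} {v} v∈part with p v ≟ᶠ i | lookup-part p i v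
... | yes pv≡i | _      = pv≡i
... | no _     | lookup≡ = contradiction (trans (sym lookup≡) v∈part) (λ ())

∉part⇒≢ : ∀ {n k} (p : Fin n → Fin k) {i v} → lookup (part p i) v ≡ false → p v ≢ i
∉part⇒≢ p {i} {v} v∉part with p v ≟ᶠ i | lookup-part p i v
... | yes _    | lookup≡ = contradiction (trans (sym lookup≡) v∉part) (λ ())
... | no pv≢i  | _      = pv≢i

toggle-part-cost : ∀ {n k} (p : Fin n → Fin k) (B : Subset n) (S T : Subset k) {i} →
  lookup S i ≡ true → lookup T i ≡ false → (∀ j → j ≢ i → lookup T j ≡ lookup S j) →
  ∣ U p S △ B ∣ + ∣ part p i ∩ B ∣ ≡ ∣ U p T △ B ∣ + ∣ part p i ─ B ∣
toggle-part-cost p B S T {i} i∈S i∉T T≗S =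
  ∣p△r∣+∣q∩r∣≡∣p′△r∣+∣q─r∣ (U p S) (U p T) (part p i) B on-part off-part
  where
  on-part : ∀ v → lookup (part p i) v ≡ true → lookup (U p S) v ≡ true × lookup (U p T) v ≡ false
  on-part v v∈part rewrite lookup-U p S v | lookup-U p T v | ∈part⇒≡ p v∈part = i∈S , i∉T
  off-part : ∀ v → lookup (part p i) v ≡ false → lookup (U p T) v ≡ lookup (U p S) v
  off-part v v∉part rewrite lookup-U p S v | lookup-U p T v = T≗S (p v) (∉part⇒≢ p v∉part)

suc-∣p[x]≔false∣ : ∀ {n} (p : Subset n) x → lookup p x ≡ true → suc ∣ p [ x ]≔ false ∣ ≡ ∣ p ∣
suc-∣p[x]≔false∣ (_ ∷ p) zero    refl = refl
suc-∣p[x]≔false∣ (b ∷ p) (suc x) x∈p = begin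
  suc ∣ b ∷ p [ x ]≔ false ∣    ≡⟨ cong suc (∣x∷p∣ b (p [ x ]≔ false)) ⟩
  suc (bit b + ∣ p [ x ]≔ false ∣) ≡⟨ +-suc (bit b) _ ⟨
  bit b + suc ∣ p [ x ]≔ false ∣ ≡⟨ cong (bit b +_) (suc-∣p[x]≔false∣ p x x∈p) ⟩
  bit b + ∣ p ∣                   ≡⟨ ∣x∷p∣ b p ⟨
  ∣ b ∷ p ∣                       ∎
  where open ≡-Reasoning

∣p[x]≔true∣ : ∀ {n} (p : Subset n) x → lookup p x ≡ false → ∣ p [ x ]≔ true ∣ ≡ suc ∣ p ∣
∣p[x]≔true∣ (_ ∷ p) zero    refl = refl
∣p[x]≔true∣ (b ∷ p) (suc x) x∉p = begin
  ∣ b ∷ p [ x ]≔ true ∣         ≡⟨ ∣x∷p∣ b (p [ x ]≔ true) ⟩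
  bit b + ∣ p [ x ]≔ true ∣     ≡⟨ cong (bit b +_) (∣p[x]≔true∣ p x x∉p) ⟩
  bit b + suc ∣ p ∣             ≡⟨ +-suc (bit b) _ ⟩
  suc (bit b + ∣ p ∣)           ≡⟨ cong suc (∣x∷p∣ b p) ⟨
  suc ∣ b ∷ p ∣                 ∎
  where open ≡-Reasoning

Proper : ∀ {k} → Subset k → Set
Proper S = S ≢ ⊥ × S ≢ ⊤

remove-proper : ∀ {k} (S : Subset k) i → ∣ S ∣ ≢ 1 → lookup S i ≡ true → Proper (S [ i ]≔ false)
remove-proper {k} S i ∣S∣≢1 i∈S = nonempty , nonfull
  where
  open ≡-Reasoning
  nonempty : S [ i ]≔ false ≢ ⊥
  nonempty S-i≡⊥ = ∣S∣≢1 (begin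
    ∣ S ∣                  ≡⟨ suc-∣p[x]≔false∣ S i i∈S ⟨
    suc ∣ S [ i ]≔ false ∣ ≡⟨ cong (λ T → suc ∣ T ∣) S-i≡⊥ ⟩
    suc ∣ ⊥ {k} ∣          ≡⟨ cong suc (∣⊥∣≡0 k) ⟩
    1                      ∎)
  nonfull : S [ i ]≔ false ≢ ⊤
  nonfull S-i≡⊤ = contradiction
    (trans (sym (lookup∘update i S false)) ([]=⇒lookup (subst (i ∈_) (sym S-i≡⊤) ∈⊤))) (λ ())

add-proper : ∀ {k} (S : Subset k) i → ∣ S ∣ ≢ k ∸ 1 → lookup S i ≡ false → Proper (S [ i ]≔ true)
add-proper {k} S i ∣S∣≢k-1 i∉S = nonempty , nonfull
  where
  open ≡-Reasoning
  nonempty : S [ i ]≔ true ≢ ⊥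
  nonempty S+i≡⊥ =
    ∉⊥ (lookup⇒[]= i ⊥ (trans (cong (λ T → lookup T i) (sym S+i≡⊥)) (lookup∘update i S true)))
  nonfull : S [ i ]≔ true ≢ ⊤
  nonfull S+i≡⊤ = ∣S∣≢k-1 (begin
    ∣ S ∣                      ≡⟨⟩
    suc ∣ S ∣ ∸ 1              ≡⟨ cong (_∸ 1) (∣p[x]≔true∣ S i i∉S) ⟨
    ∣ S [ i ]≔ true ∣ ∸ 1      ≡⟨ cong (λ T → ∣ T ∣ ∸ 1) S+i≡⊤ ⟩
    ∣ ⊤ {k} ∣ ∸ 1              ≡⟨ cong (_∸ 1) (∣⊤∣≡n k) ⟩
    k ∸ 1                      ∎)

≤-from-+-balance : ∀ {a b x y} → a ≤ b → a + x ≡ b + y → y ≤ x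
≤-from-+-balance {a} {b} {x} {y} a≤b balance = +-cancelˡ-≤ a y x (begin
  a + y ≤⟨ +-monoˡ-≤ y a≤b ⟩
  b + y ≡⟨ balance ⟨
  a + x ∎)
  where open ≤-Reasoning

module _ {n k} (p : Fin n → Fin k) (B : Subset n) (S : Subset k)
         (S-optimal : ∀ T → Proper T → ∣ U p S △ B ∣ ≤ ∣ U p T △ B ∣) where

  inside-majority : ∣ S ∣ ≢ 1 → ∀ i → lookup S i ≡ true → ∣ part p i ∣ ≤ 2 * ∣ part p i ∩ B ∣
  inside-majority ∣S∣≢1 i i∈S = begin
    ∣ part p i ∣                      ≡⟨ ∣p∣≡∣p∩q∣+∣p─q∣ (part p i) B ⟩
    ∣ part p i ∩ B ∣ + ∣ part p i ─ B ∣ ≤⟨ +-monoʳ-≤ ∣ part p i ∩ B ∣ out≤in ⟩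
    ∣ part p i ∩ B ∣ + ∣ part p i ∩ B ∣ ≡⟨ cong (∣ part p i ∩ B ∣ +_) (+-identityʳ _) ⟨
    2 * ∣ part p i ∩ B ∣              ∎
    where
    open ≤-Reasoning
    out≤in : ∣ part p i ─ B ∣ ≤ ∣ part p i ∩ B ∣
    out≤in = ≤-from-+-balance (S-optimal _ (remove-proper S i ∣S∣≢1 i∈S))
      (toggle-part-cost p B S (S [ i ]≔ false) i∈S (lookup∘update i S false)
         (λ j j≢i → lookup∘update′ j≢i S false))

  outside-minority : ∣ S ∣ ≢ k ∸ 1 → ∀ i → lookup S i ≡ false → 2 * ∣ part p i ∩ B ∣ ≤ ∣ part p i ∣
  outside-minority ∣S∣≢k-1 i i∉S = begin
    2 * ∣ part p i ∩ B ∣              ≡⟨ cong (∣ part p i ∩ B ∣ +_) (+-identityʳ _) ⟩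
    ∣ part p i ∩ B ∣ + ∣ part p i ∩ B ∣ ≤⟨ +-monoʳ-≤ ∣ part p i ∩ B ∣ in≤out ⟩
    ∣ part p i ∩ B ∣ + ∣ part p i ─ B ∣ ≡⟨ ∣p∣≡∣p∩q∣+∣p─q∣ (part p i) B ⟨
    ∣ part p i ∣                      ∎
    where
    open ≤-Reasoning
    in≤out : ∣ part p i ∩ B ∣ ≤ ∣ part p i ─ B ∣
    in≤out = ≤-from-+-balance (S-optimal _ (add-proper S i ∣S∣≢k-1 i∉S))
      (sym (toggle-part-cost p B (S [ i ]≔ true) S (lookup∘update i S true) i∉S
              (λ j j≢i → sym (lookup∘update′ j≢i S true))))

proposition12 : ∀ {n k k' : ℕ} (p : Fin n → Fin k) (p' : Fin n → Fin k') →
    IsPartition p → IsPartition p' → 2 ≤ k → 2 ≤ k' →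
    (S : Subset k) (S' : Subset k') →
    IsOptimal p p' S S' → ¬ IsMutual p p' S S' →
    (∣ S ∣ ≡ 1 ⊎ ∣ S ∣ ≡ k ∸ 1) ⊎ (∣ S' ∣ ≡ 1 ⊎ ∣ S' ∣ ≡ k' ∸ 1)
proposition12 {k = k} {k'} p p' _ _ _ _ S S' ((S≢⊥ , S≢⊤ , S'≢⊥ , S'≢⊤) , optimal) not-mutual
  with ∣ S ∣ ≟ 1 | ∣ S ∣ ≟ k ∸ 1 | ∣ S' ∣ ≟ 1 | ∣ S' ∣ ≟ k' ∸ 1
... | yes ∣S∣≡1 | _ | _ | _ = inj₁ (inj₁ ∣S∣≡1)
... | no _ | yes ∣S∣≡k-1 | _ | _ = inj₁ (inj₂ ∣S∣≡k-1)
... | no _ | no _ | yes ∣S'∣≡1 | _ = inj₂ (inj₁ ∣S'∣≡1)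
... | no _ | no _ | no _ | yes ∣S'∣≡k'-1 = inj₂ (inj₂ ∣S'∣≡k'-1)
... | no ∣S∣≢1 | no ∣S∣≢k-1 | no ∣S'∣≢1 | no ∣S'∣≢k'-1 = ⊥-elim (not-mutual
  ( inside-majority p (U p' S') S S-optimal ∣S∣≢1
  , outside-minority p (U p' S') S S-optimal ∣S∣≢k-1
  , inside-majority p' (U p S) S' S'-optimal ∣S'∣≢1
  , outside-minority p' (U p S) S' S'-optimal ∣S'∣≢k'-1 ))
  where
  S-optimal : ∀ T → Proper T → ∣ U p S △ U p' S' ∣ ≤ ∣ U p T △ U p' S' ∣
  S-optimal T (T≢⊥ , T≢⊤) = optimal T S' (T≢⊥ , T≢⊤ , S'≢⊥ , S'≢⊤)
  S'-optimal : ∀ T' → Proper T' → ∣ U p' S' △ U p S ∣ ≤ ∣ U p' T' △ U p S ∣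
  S'-optimal T' T'-proper =
    subst₂ _≤_ (cong ∣_∣ (△-comm (U p S) (U p' S'))) (cong ∣_∣ (△-comm (U p S) (U p' T')))
      (optimal S T' (S≢⊥ , S≢⊤ , T'-proper))
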